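{- Let $z$ be an indeterminate and let $(N_{n,k}(z))$ be defined by $N_{0,0}=1$, $N_{0,k}=0$ ($k>0$), and for $n\ge1$, $N_{n,k}=N_{n-1,k-1}+(z+1)N_{n-1,k}+zN_{n-1,k+1}$ for all $k\ge0$ (with $N_{n-1,-1}=0$); let $N_n(z)=N_{n,0}(z)$. For integers $m,n\ge0$ define $$F_{m,n}(z)=\sum_{k=0}^{n}(-z)^k\det\begin{pmatrix}N_{n,k}(z)&N_{n,k+1}(z)\\ N_{m,k}(z)&N_{m,k+1}(z)\end{pmatrix}.$$ Then for all $m\ge1$, $n\ge0$, $F_{m,n}(z)=2(z+1)F_{m-1,n}(z)-F_{m-1,n+1}(z)$; moreover $F_{n,n}(z)=0$ and $F_{n+1,n}(z)=N_n(z^2)$ for all $n\ge0$; and for all $m>n\ge0$, $$F_{m,n}(z)=\sum_{j=0}^{\lfloor\frac{m-n-1}{2}\rfloor}(-1)^j\binom{m-n-1-j}{j}N_{n+j}(z^2)\big(2(z+1)\big)^{m-n-1-2j}.$$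
   Context: Explicitly, $N_n(z)=\sum_{i=0}^{n}\frac{1}{n+1}\binom{n+1}{i}\binom{n+1}{i+1}z^i$ (Narayana polynomials). -}

module Defs where

open import Level using (Level)
open import Data.Nat using (ℕ; zero; suc; _∸_; _/_)
open import Data.Nat.Combinatorics using (_C_)
open import Algebra.Bundles using (CommutativeRing; Semiring)
import Algebra.Definitions.RawSemiring as RS

-- Polynomial identities in ℤ[z] are stated as identities holding for every
-- element z of every commutative ring R (universal property of ℤ[z]).
module Narayana {c ℓ : Level} (R : CommutativeRing c ℓ) where
  open CommutativeRing R public using (Carrier; _≈_; _+_; _*_; -_; _-_; 0#; 1#; semiring)
  open RS (Semiring.rawSemiring semiring) public using (_×_; _^_)

  two : Carrier
  two = 2 × 1#

  N : ℕ → ℕ → Carrier → Carrier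
  N zero    zero    z = 1#
  N zero    (suc k) z = 0#
  N (suc n) zero    z = (z + 1#) * N n zero z + z * N n 1 z
  N (suc n) (suc k) z = N n k z + (z + 1#) * N n (suc k) z + z * N n (suc (suc k)) z

  Nar : ℕ → Carrier → Carrier
  Nar n z = N n 0 z

  det2 : Carrier → Carrier → Carrier → Carrier → Carrier
  det2 a b c' d = a * d - b * c'

  sumTo : ℕ → (ℕ → Carrier) → Carrier
  sumTo zero    f = f 0
  sumTo (suc n) f = sumTo n f + f (suc n)

  F : ℕ → ℕ → Carrier → Carrier
  F m n z = sumTo n (λ k → ((- z) ^ k) *
              det2 (N n k z) (N n (suc k) z) (N m k z) (N m (suc k) z))

  closedForm : ℕ → ℕ → Carrier → Carrier
  closedForm m n z = sumTo ((m ∸ n ∸ 1) / 2) (λ j →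
      ((- 1#) ^ j) * (((m ∸ n ∸ 1 ∸ j) C j) × 1#) * Nar (n Data.Nat.+ j) (z * z)
        * (two * (z + 1#)) ^ (m ∸ n ∸ 1 ∸ (2 Data.Nat.* j)))

module Submission where

-- Let T act on sequences by (T a)ₖ = aₖ₋₁ + (z+1) aₖ + z aₖ₊₁, so that row n of the triangle,
-- k ↦ N_{n,k}, is Tⁿ e₀, and let B_L(a, b) = Σ_{k ≤ L} (-z)ᵏ (aₖ bₖ₊₁ - aₖ₊₁ bₖ); then
-- F_{m,n} = B_n(row n, row m). Summation by parts shows B(a, T b) = B(T† a, b) with T† = 2(z+1) - T
-- whenever a boundary term vanishes, as it does for the finitely supported rows. Moving one factor T
-- of row m+1 across gives the recurrence; moving all n+1 factors of row n+1 leaves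
-- B(T†ⁿ⁺¹ row n, e₀) = -(T† (T†T)ⁿ e₀)₁, and the functionals Λⱼ intertwine T†T with the operator T
-- at z², which turns this into N_n(z²). Together with F_{n,n} = 0 the recurrence then determines
-- F_{n+1+d,n}, and the closed form, a Chebyshev-type sum, satisfies the same recurrence by Pascal's rule.

open import Defs
open import Level using (Level)
open import Data.Nat using (ℕ; suc; _<_)
open import Data.Product using (_,_) renaming (_×_ to _∧_)
open import Algebra.Bundles using (CommutativeRing)

open import Data.Nat as ℕ using (zero; _≤_; z≤n; s≤s; _∸_; _/_; pred)
import Data.Nat.Properties as ℕₚ
open import Data.Nat.DivMod using (m*n/n≡m; /-monoˡ-≤; m/n≤m)
open import Data.Nat.Combinatorics using (_C_; k>n⇒nCk≡0; nCk+nC[k+1]≡[n+1]C[k+1])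
open import Data.Integer as ℤ using (ℤ; +_; -[1+_]; _⊖_; _◃_; sign; ∣_∣)
open import Data.Integer.Properties using (+-*-commutativeRing; [1+m]⊖[1+n]≡m⊖n; ◃-inverse)
open import Data.Sign as Sign using (Sign)
open import Data.Maybe using (Maybe; just; nothing)
open import Data.List using (List; []; _∷_)
open import Data.Sum using (inj₁; inj₂)
open import Function using (_∘_)
open import Relation.Nullary using (yes; no)
open import Relation.Binary.PropositionalEquality as ≡ using (_≡_)

module IntegerCoefficientSolver {c ℓ : Level} (R : CommutativeRing c ℓ) where
  open CommutativeRing R
  open import Algebra.Properties.Ring ring using (-0#≈0#; -‿involutive; -‿+-comm; -1*x≈-x)
  open import Algebra.Properties.Semiring.Mult semiring using (_×_; ×-homo-+; ×1-homo-*)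
  open import Algebra.Properties.CommutativeSemigroup *-commutativeSemigroup using (interchange)
  open import Algebra.Solver.Ring.AlmostCommutativeRing using (fromCommutativeRing; _-Raw-AlmostCommutative⟶_)
  open import Relation.Binary.Reasoning.Setoid setoid

  -- Special-cased at 1 so that the solver's constants 0, 1 and 2 denote 0#, 1# and two on the nose.
  cast : ℕ → Carrier
  cast zero = 0#
  cast 1 = 1#
  cast n@(suc (suc _)) = n × 1#

  cast≈× : ∀ n → cast n ≈ n × 1#
  cast≈× zero = refl
  cast≈× 1 = sym (+-identityʳ 1#)
  cast≈× (suc (suc n)) = refl

  ⟦_⟧ : ℤ → Carrier
  ⟦ + n ⟧ = cast n
  ⟦ -[1+ n ] ⟧ = - cast (suc n)

  ⟦sign⟧ : Sign → Carrier
  ⟦sign⟧ Sign.+ = 1#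
  ⟦sign⟧ Sign.- = - 1#

  ⟦sign⟧-homo : ∀ s t → ⟦sign⟧ (s Sign.* t) ≈ ⟦sign⟧ s * ⟦sign⟧ t
  ⟦sign⟧-homo Sign.+ t = sym (*-identityˡ _)
  ⟦sign⟧-homo Sign.- Sign.+ = sym (*-identityʳ _)
  ⟦sign⟧-homo Sign.- Sign.- = sym (trans (-1*x≈-x (- 1#)) (-‿involutive 1#))

  ◃-homo : ∀ s n → ⟦ s ◃ n ⟧ ≈ ⟦sign⟧ s * (n × 1#)
  ◃-homo s zero = sym (zeroʳ _)
  ◃-homo Sign.+ (suc n) = trans (cast≈× (suc n)) (sym (*-identityˡ _))
  ◃-homo Sign.- (suc n) = trans (-‿cong (cast≈× (suc n))) (sym (-1*x≈-x _))

  [u+x]-[u+y]≈x-y : ∀ u x y → (u + x) - (u + y) ≈ x - y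
  [u+x]-[u+y]≈x-y u x y = begin
    (u + x) + - (u + y)    ≈⟨ +-cong (+-comm u x) (sym (-‿+-comm u y)) ⟩
    (x + u) + (- u + - y)  ≈⟨ +-assoc x u _ ⟩
    x + (u + (- u + - y))  ≈⟨ +-congˡ (sym (+-assoc u (- u) (- y))) ⟩
    x + ((u - u) + - y)    ≈⟨ +-congˡ (trans (+-congʳ (-‿inverseʳ u)) (+-identityˡ (- y))) ⟩
    x - y                  ∎

  ⊖-homo : ∀ m n → ⟦ m ⊖ n ⟧ ≈ m × 1# - n × 1#
  ⊖-homo m zero = trans (cast≈× m) (sym (trans (+-congˡ -0#≈0#) (+-identityʳ _)))
  ⊖-homo zero (suc n) = trans (-‿cong (cast≈× (suc n))) (sym (+-identityˡ _))
  ⊖-homo (suc m) (suc n) = begin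
    ⟦ suc m ⊖ suc n ⟧          ≡⟨ ≡.cong ⟦_⟧ ([1+m]⊖[1+n]≡m⊖n m n) ⟩
    ⟦ m ⊖ n ⟧                  ≈⟨ ⊖-homo m n ⟩
    m × 1# - n × 1#            ≈⟨ [u+x]-[u+y]≈x-y 1# _ _ ⟨
    suc m × 1# - suc n × 1#    ∎

  +-homo : ∀ i j → ⟦ i ℤ.+ j ⟧ ≈ ⟦ i ⟧ + ⟦ j ⟧
  +-homo (+ m) (+ n) = begin
    cast (m ℕ.+ n)         ≈⟨ cast≈× (m ℕ.+ n) ⟩
    (m ℕ.+ n) × 1#         ≈⟨ ×-homo-+ 1# m n ⟩
    m × 1# + n × 1#        ≈⟨ +-cong (cast≈× m) (cast≈× n) ⟨
    cast m + cast n        ∎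
  +-homo (+ m) -[1+ n ] = trans (⊖-homo m (suc n)) (+-cong (sym (cast≈× m)) (-‿cong (sym (cast≈× (suc n)))))
  +-homo -[1+ m ] (+ n) = trans (⊖-homo n (suc m))
    (trans (+-comm _ _) (+-cong (-‿cong (sym (cast≈× (suc m)))) (sym (cast≈× n))))
  +-homo -[1+ m ] -[1+ n ] = begin
    - (suc (suc (m ℕ.+ n)) × 1#)          ≡⟨ ≡.cong (λ k → - (k × 1#)) (≡.sym (ℕₚ.+-suc (suc m) n)) ⟩
    - ((suc m ℕ.+ suc n) × 1#)            ≈⟨ -‿cong (×-homo-+ 1# (suc m) (suc n)) ⟩
    - (suc m × 1# + suc n × 1#)           ≈⟨ -‿+-comm _ _ ⟨
    - (suc m × 1#) + - (suc n × 1#)       ≈⟨ +-cong (-‿cong (cast≈× (suc m))) (-‿cong (cast≈× (suc n))) ⟨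
    - cast (suc m) + - cast (suc n)       ∎

  ⟦⟧-sign-abs : ∀ i → ⟦ i ⟧ ≈ ⟦sign⟧ (sign i) * (∣ i ∣ × 1#)
  ⟦⟧-sign-abs i = trans (reflexive (≡.cong ⟦_⟧ (≡.sym (◃-inverse i)))) (◃-homo (sign i) ∣ i ∣)

  *-homo : ∀ i j → ⟦ i ℤ.* j ⟧ ≈ ⟦ i ⟧ * ⟦ j ⟧
  *-homo i j = begin
    ⟦ sign i Sign.* sign j ◃ ∣ i ∣ ℕ.* ∣ j ∣ ⟧
      ≈⟨ ◃-homo (sign i Sign.* sign j) (∣ i ∣ ℕ.* ∣ j ∣) ⟩
    ⟦sign⟧ (sign i Sign.* sign j) * ((∣ i ∣ ℕ.* ∣ j ∣) × 1#)
      ≈⟨ *-cong (⟦sign⟧-homo (sign i) (sign j)) (×1-homo-* ∣ i ∣ ∣ j ∣) ⟩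
    (⟦sign⟧ (sign i) * ⟦sign⟧ (sign j)) * ((∣ i ∣ × 1#) * (∣ j ∣ × 1#))
      ≈⟨ interchange _ _ _ _ ⟩
    (⟦sign⟧ (sign i) * (∣ i ∣ × 1#)) * (⟦sign⟧ (sign j) * (∣ j ∣ × 1#))
      ≈⟨ *-cong (⟦⟧-sign-abs i) (⟦⟧-sign-abs j) ⟨
    ⟦ i ⟧ * ⟦ j ⟧ ∎

  -‿homo : ∀ i → ⟦ ℤ.- i ⟧ ≈ - ⟦ i ⟧
  -‿homo (+ zero) = sym -0#≈0#
  -‿homo (+ suc n) = refl
  -‿homo -[1+ n ] = sym (-‿involutive _)

  morphism : CommutativeRing.rawRing +-*-commutativeRing -Raw-AlmostCommutative⟶ fromCommutativeRing R
  morphism = record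
    { ⟦_⟧ = ⟦_⟧ ; +-homo = +-homo ; *-homo = *-homo ; -‿homo = -‿homo ; 0-homo = refl ; 1-homo = refl }

  ⟦⟧-≟ : ∀ i j → Maybe (⟦ i ⟧ ≈ ⟦ j ⟧)
  ⟦⟧-≟ i j with i ℤ.≟ j
  ... | yes ≡.refl = just refl
  ... | no _ = nothing

  open import Algebra.Solver.Ring
    (CommutativeRing.rawRing +-*-commutativeRing) (fromCommutativeRing R) morphism ⟦⟧-≟ public
    using (Polynomial; solve; _:=_; con; _:+_; _:*_; _:-_; :-_)

double : ℕ → ℕ
double zero    = zero
double (suc j) = suc (suc (double j))

double≡+ : ∀ j → double j ≡ j ℕ.+ j
double≡+ zero    = ≡.refl
double≡+ (suc j) = ≡.cong suc (≡.trans (≡.cong suc (double≡+ j)) (≡.sym (ℕₚ.+-suc j j)))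

double≡2* : ∀ j → double j ≡ 2 ℕ.* j
double≡2* j = ≡.trans (double≡+ j) (≡.cong (j ℕ.+_) (≡.sym (ℕₚ.+-identityʳ j)))

/2<⇒<double : ∀ d j → d / 2 < j → d < double j
/2<⇒<double d j d/2<j = ≡.subst (d <_) (≡.sym (≡.trans (double≡2* j) (ℕₚ.*-comm 2 j)))
  (ℕₚ.≰⇒> λ j*2≤d → ℕₚ.<⇒≱ d/2<j (≡.subst (_≤ d / 2) (m*n/n≡m j 2) (/-monoˡ-≤ 2 j*2≤d)))

≤double⇒C≡0 : ∀ d j → d ≤ double j → (d ∸ j) C suc j ≡ 0
≤double⇒C≡0 d j d≤2j = k>n⇒nCk≡0 (s≤s (ℕₚ.m≤n+o⇒m∸n≤o d j (≡.subst (d ≤_) (double≡+ j) d≤2j)))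

<double⇒C≡0 : ∀ d j → d < double j → (d ∸ j) C j ≡ 0
<double⇒C≡0 zero    (suc j) _                  = ≡.refl
<double⇒C≡0 (suc d) (suc j) (s≤s (s≤s d≤2j)) = ≤double⇒C≡0 d j d≤2j

pascal-∸ : ∀ d j → (suc d ∸ j) C suc j ≡ (d ∸ j) C j ℕ.+ (d ∸ j) C suc j
pascal-∸ d j with j ℕₚ.≤? d
... | yes j≤d = ≡.trans (≡.cong (_C suc j) (ℕₚ.+-∸-assoc 1 j≤d)) (≡.sym (nCk+nC[k+1]≡[n+1]C[k+1] (d ∸ j) j))
... | no j≰d = ≡.trans (≡.cong (_C suc j) (ℕₚ.m≤n⇒m∸n≡0 d<j))
                (≡.sym (≡.cong₂ ℕ._+_ (≡.trans (≡.cong (_C j) d∸j≡0) (k>n⇒nCk≡0 (ℕₚ.≤-<-trans z≤n d<j)))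
                                       (≡.cong (_C suc j) d∸j≡0)))
  where
  d<j = ℕₚ.≰⇒> j≰d
  d∸j≡0 = ℕₚ.m≤n⇒m∸n≡0 (ℕₚ.<⇒≤ d<j)

suc[m∸n∸1+n]≡m : ∀ {m n} → n < m → suc (m ∸ n ∸ 1 ℕ.+ n) ≡ m
suc[m∸n∸1+n]≡m {suc m} {n} (s≤s n≤m) =
  ≡.cong suc (≡.trans (≡.cong (λ k → k ∸ 1 ℕ.+ n) (ℕₚ.+-∸-assoc 1 n≤m)) (ℕₚ.m∸n+n≡m n≤m))

module NarayanaDeterminants {c ℓ : Level} (R : CommutativeRing c ℓ) where
  open Narayana R
  open CommutativeRing R
    using (setoid; refl; sym; trans; reflexive; +-cong; +-congˡ; +-congʳ; *-cong; *-congˡ; *-congʳ; -‿cong)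
  open import Relation.Binary.Reasoning.Setoid setoid
  open import Algebra.Properties.Semiring.Mult semiring using (×-homo-+)
  open IntegerCoefficientSolver R using (Polynomial; solve; _:=_; con; _:+_; _:*_; _:-_; :-_)

  private
    0ₚ 1ₚ 2ₚ : ∀ {k} → Polynomial k
    0ₚ = con (+ 0)
    1ₚ = con (+ 1)
    2ₚ = con (+ 2)

  sumTo-cong : ∀ L {f g : ℕ → Carrier} → (∀ k → f k ≈ g k) → sumTo L f ≈ sumTo L g
  sumTo-cong zero    f≈g = f≈g 0
  sumTo-cong (suc L) f≈g = +-cong (sumTo-cong L f≈g) (f≈g (suc L))

  sumTo-zero : ∀ L {f : ℕ → Carrier} → (∀ k → f k ≈ 0#) → sumTo L f ≈ 0#
  sumTo-zero zero    f≈0 = f≈0 0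
  sumTo-zero (suc L) f≈0 = trans (+-cong (sumTo-zero L f≈0) (f≈0 (suc L))) (solve 0 (0ₚ :+ 0ₚ := 0ₚ) refl)

  sumTo-extend : ∀ L (f : ℕ → Carrier) → f (suc L) ≈ 0# → sumTo (suc L) f ≈ sumTo L f
  sumTo-extend L f f≈0 = trans (+-congˡ f≈0) (solve 1 (λ x → x :+ 0ₚ := x) refl (sumTo L f))

  sumTo-linear : ∀ L x (f g : ℕ → Carrier) → sumTo L (λ k → x * f k - g k) ≈ x * sumTo L f - sumTo L g
  sumTo-linear zero    x f g = refl
  sumTo-linear (suc L) x f g = trans (+-congʳ (sumTo-linear L x f g))
    (solve 5 (λ x F G f g → (x :* F :- G) :+ (x :* f :- g) := x :* (F :+ f) :- (G :+ g)) refl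
      x (sumTo L f) (sumTo L g) (f (suc L)) (g (suc L)))

  sumTo-unroll : ∀ K (f : ℕ → Carrier) → sumTo (suc K) f ≈ f 0 + sumTo K (λ j → f (suc j))
  sumTo-unroll zero    f = refl
  sumTo-unroll (suc K) f = trans (+-congʳ (sumTo-unroll K f))
    (solve 3 (λ x y z → (x :+ y) :+ z := x :+ (y :+ z)) refl _ _ _)

  sumTo-truncate : ∀ {K L} (f : ℕ → Carrier) → K ≤ L → (∀ j → K < j → f j ≈ 0#) → sumTo L f ≈ sumTo K f
  sumTo-truncate {L = zero} f z≤n _ = refl
  sumTo-truncate {K} {suc L} f K≤1+L tail with ℕₚ.m≤n⇒m<n∨m≡n K≤1+L
  ... | inj₂ ≡.refl = refl
  ... | inj₁ (s≤s K≤L) =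
    trans (sumTo-extend L f (tail (suc L) (s≤s K≤L))) (sumTo-truncate f K≤L tail)

  chebyshevTerm : Carrier → (ℕ → Carrier) → ℕ → ℕ → Carrier
  chebyshevTerm c f d j = (- 1#) ^ j * (((d ∸ j) C j) × 1#) * f j * c ^ (d ∸ double j)

  chebyshev : Carrier → (ℕ → Carrier) → ℕ → Carrier
  chebyshev c f d = sumTo d (chebyshevTerm c f d)

  chebyshevTerm-vanishes : ∀ c f d j → (d ∸ j) C j ≡ 0 → chebyshevTerm c f d j ≈ 0#
  chebyshevTerm-vanishes c f d j C≡0 = trans (*-congʳ (*-congʳ (*-congˡ (reflexive (≡.cong (_× 1#) C≡0)))))
    (solve 3 (λ s x y → s :* 0ₚ :* x :* y := 0ₚ) refl _ _ _)

  *-^-pred : ∀ c b e → (e ≡ 0 → b ≈ 0#) → b * c ^ e ≈ c * (b * c ^ pred e)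
  *-^-pred c b zero    b≈0 = begin
    b * 1#        ≈⟨ *-congʳ (b≈0 ≡.refl) ⟩
    0# * 1#       ≈⟨ solve 1 (λ c → 0ₚ :* 1ₚ := c :* (0ₚ :* 1ₚ)) refl c ⟩
    c * (0# * 1#) ≈⟨ *-congˡ (*-congʳ (b≈0 ≡.refl)) ⟨
    c * (b * 1#)  ∎
  *-^-pred c b (suc e) _   = solve 3 (λ c b p → b :* (c :* p) := c :* (b :* p)) refl c b (c ^ e)

  chebyshevTerm-pascal : ∀ c f d j →
    chebyshevTerm c f (suc (suc d)) (suc j)
      ≈ c * chebyshevTerm c f (suc d) (suc j) - chebyshevTerm c (λ i → f (suc i)) d j
  chebyshevTerm-pascal c f d j = begin
    - 1# * s * (((suc d ∸ j) C suc j) × 1#) * x * c ^ e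
      ≈⟨ *-congʳ (*-congʳ (*-congˡ binomial≈a+b)) ⟩
    - 1# * s * (a + b) * x * c ^ e
      ≈⟨ solve 5 (λ s a b x p → :- 1ₚ :* s :* (a :+ b) :* x :* p
                              := :- 1ₚ :* s :* x :* (b :* p) :- s :* a :* x :* p) refl s a b x (c ^ e) ⟩
    - 1# * s * x * (b * c ^ e) - s * a * x * c ^ e
      ≈⟨ +-congʳ (*-congˡ (*-^-pred c b e b≈0)) ⟩
    - 1# * s * x * (c * (b * c ^ pred e)) - s * a * x * c ^ e
      ≈⟨ solve 7 (λ c s a b x q p → :- 1ₚ :* s :* x :* (c :* (b :* q)) :- s :* a :* x :* p
                                  := c :* (:- 1ₚ :* s :* b :* x :* q) :- s :* a :* x :* p) refl
                   c s a b x (c ^ pred e) (c ^ e) ⟩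
    c * (- 1# * s * b * x * c ^ pred e) - s * a * x * c ^ e
      ≡⟨ ≡.cong (λ k → c * (- 1# * s * b * x * c ^ k) - s * a * x * c ^ e)
                (ℕₚ.pred[m∸n]≡m∸[1+n] d (double j)) ⟩
    c * (- 1# * s * b * x * c ^ (d ∸ suc (double j))) - s * a * x * c ^ e ∎
    where
    s = (- 1#) ^ j
    a = ((d ∸ j) C j) × 1#
    b = ((d ∸ j) C suc j) × 1#
    x = f (suc j)
    e = d ∸ double j

    binomial≈a+b : ((suc d ∸ j) C suc j) × 1# ≈ a + b
    binomial≈a+b = trans (reflexive (≡.cong (_× 1#) (pascal-∸ d j))) (×-homo-+ 1# ((d ∸ j) C j) ((d ∸ j) C suc j))

    b≈0 : e ≡ 0 → b ≈ 0#
    b≈0 e≡0 = reflexive (≡.cong (_× 1#) (≤double⇒C≡0 d j (ℕₚ.m∸n≡0⇒m≤n e≡0)))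

  chebyshevTerm-head : ∀ c f d → chebyshevTerm c f (suc (suc d)) 0 ≈ c * chebyshevTerm c f (suc d) 0
  chebyshevTerm-head c f d = solve 3 (λ c x p → 1ₚ :* (1ₚ :+ 0ₚ) :* x :* (c :* p) := c :* (1ₚ :* (1ₚ :+ 0ₚ) :* x :* p))
    refl c (f 0) (c ^ suc d)

  chebyshevTerm-beyond : ∀ c f d → chebyshevTerm c f d (suc d) ≈ 0#
  chebyshevTerm-beyond c f d =
    chebyshevTerm-vanishes c f d (suc d) (≡.cong (_C suc d) (ℕₚ.m≤n⇒m∸n≡0 (ℕₚ.n≤1+n d)))

  chebyshev-cong : ∀ c {f g : ℕ → Carrier} d → (∀ j → f j ≈ g j) → chebyshev c f d ≈ chebyshev c g d
  chebyshev-cong c d f≈g = sumTo-cong d (λ j → *-congʳ (*-congˡ (f≈g j)))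

  chebyshev-recurrence : ∀ c f d →
    chebyshev c f (suc (suc d)) ≈ c * chebyshev c f (suc d) - chebyshev c (λ j → f (suc j)) d
  chebyshev-recurrence c f d = begin
    sumTo (suc (suc d)) t₂
      ≈⟨ sumTo-unroll (suc d) t₂ ⟩
    t₂ 0 + sumTo (suc d) (t₂ ∘ suc)
      ≈⟨ +-cong (chebyshevTerm-head c f d) (sumTo-cong (suc d) (chebyshevTerm-pascal c f d)) ⟩
    c * t₁ 0 + sumTo (suc d) (λ j → c * t₁ (suc j) - t₀ j)
      ≈⟨ +-congˡ (sumTo-linear (suc d) c (t₁ ∘ suc) t₀) ⟩
    c * t₁ 0 + (c * sumTo (suc d) (t₁ ∘ suc) - sumTo (suc d) t₀)
      ≈⟨ solve 4 (λ c x y z → c :* x :+ (c :* y :- z) := c :* (x :+ y) :- z) refl c _ _ _ ⟩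
    c * (t₁ 0 + sumTo (suc d) (t₁ ∘ suc)) - sumTo (suc d) t₀
      ≈⟨ +-cong (*-congˡ (sym (sumTo-unroll (suc d) t₁)))
                (-‿cong (sumTo-extend d t₀ (chebyshevTerm-beyond c (f ∘ suc) d))) ⟩
    c * sumTo (suc (suc d)) t₁ - sumTo d t₀
      ≈⟨ +-congʳ (*-congˡ (sumTo-extend (suc d) t₁ (chebyshevTerm-beyond c f (suc d)))) ⟩
    c * sumTo (suc d) t₁ - sumTo d t₀ ∎
    where
    t₂ = chebyshevTerm c f (suc (suc d))
    t₁ = chebyshevTerm c f (suc d)
    t₀ = chebyshevTerm c (f ∘ suc) d

  chebyshev-unique : ∀ c (f : ℕ → Carrier) (X : ℕ → ℕ → Carrier) →
    (∀ n → X 0 n ≈ f n) →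
    (∀ n → X 1 n ≈ c * f n) →
    (∀ d n → X (suc (suc d)) n ≈ c * X (suc d) n - X d (suc n)) →
    ∀ d n → X d n ≈ chebyshev c (λ j → f (n ℕ.+ j)) d
  chebyshev-unique c f X X₀ X₁ Xₛ = go
    where
    f-n+0 : ∀ n → f n ≈ f (n ℕ.+ 0)
    f-n+0 n = reflexive (≡.cong f (≡.sym (ℕₚ.+-identityʳ n)))

    go : ∀ d n → X d n ≈ chebyshev c (λ j → f (n ℕ.+ j)) d
    go zero n = trans (X₀ n) (trans (f-n+0 n) (solve 1 (λ x → x := 1ₚ :* (1ₚ :+ 0ₚ) :* x :* 1ₚ) refl _))
    go (suc zero) n = trans (X₁ n) (trans (*-congˡ (f-n+0 n))
      (solve 3 (λ c x y → c :* x := 1ₚ :* (1ₚ :+ 0ₚ) :* x :* (c :* 1ₚ) :+ :- 1ₚ :* 1ₚ :* 0ₚ :* y :* 1ₚ)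
        refl c _ _))
    go (suc (suc d)) n = begin
      X (suc (suc d)) n
        ≈⟨ Xₛ d n ⟩
      c * X (suc d) n - X d (suc n)
        ≈⟨ +-cong (*-congˡ (go (suc d) n)) (-‿cong (go d (suc n))) ⟩
      c * chebyshev c (λ j → f (n ℕ.+ j)) (suc d) - chebyshev c (λ j → f (suc n ℕ.+ j)) d
        ≈⟨ +-congˡ (-‿cong (chebyshev-cong c d (λ j → reflexive (≡.cong f (≡.sym (ℕₚ.+-suc n j)))))) ⟩
      c * chebyshev c (λ j → f (n ℕ.+ j)) (suc d) - chebyshev c (λ j → f (n ℕ.+ suc j)) d
        ≈⟨ chebyshev-recurrence c (λ j → f (n ℕ.+ j)) d ⟨
      chebyshev c (λ j → f (n ℕ.+ j)) (suc (suc d)) ∎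

  chebyshev-truncate : ∀ c f d →
    chebyshev c f d ≈ sumTo (d / 2) (λ j → (- 1#) ^ j * (((d ∸ j) C j) × 1#) * f j * c ^ (d ∸ 2 ℕ.* j))
  chebyshev-truncate c f d = begin
    sumTo d (chebyshevTerm c f d)
      ≈⟨ sumTo-truncate (chebyshevTerm c f d) (m/n≤m d 2)
           (λ j d/2<j → chebyshevTerm-vanishes c f d j (<double⇒C≡0 d j (/2<⇒<double d j d/2<j))) ⟩
    sumTo (d / 2) (chebyshevTerm c f d)
      ≈⟨ sumTo-cong (d / 2) (λ j → *-congˡ (reflexive (≡.cong (λ e → c ^ (d ∸ e)) (double≡2* j)))) ⟩
    sumTo (d / 2) (λ j → (- 1#) ^ j * (((d ∸ j) C j) × 1#) * f j * c ^ (d ∸ 2 ℕ.* j)) ∎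

  Seq : Set c
  Seq = ℕ → Carrier

  infix 4 _≋_
  _≋_ : Seq → Seq → Set ℓ
  a ≋ b = ∀ k → a k ≈ b k

  iterate : (Seq → Seq) → ℕ → Seq → Seq
  iterate S zero    a = a
  iterate S (suc n) a = S (iterate S n a)

  module _ {S : Seq → Seq} (S-cong : ∀ {a b} → a ≋ b → S a ≋ S b) where

    iterate-cong : ∀ n {a b} → a ≋ b → iterate S n a ≋ iterate S n b
    iterate-cong zero    a≋b = a≋b
    iterate-cong (suc n) a≋b = S-cong (iterate-cong n a≋b)

    iterate-comm : ∀ (U : Seq → Seq) → (∀ a → S (U a) ≋ U (S a)) →
                   ∀ n a → iterate S n (U a) ≋ U (iterate S n a)
    iterate-comm U comm zero    a k = refl
    iterate-comm U comm (suc n) a k = trans (S-cong (iterate-comm U comm n a) k) (comm (iterate S n a) k)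

  T : Carrier → Seq → Seq
  T z a zero    = (z + 1#) * a 0 + z * a 1
  T z a (suc k) = a k + (z + 1#) * a (suc k) + z * a (suc (suc k))

  T† : Carrier → Seq → Seq
  T† z a k = two * (z + 1#) * a k - T z a k

  minor : ℕ → ℕ → Seq → Seq → Carrier
  minor k l a b = det2 (a k) (a l) (b k) (b l)

  B : Carrier → ℕ → Seq → Seq → Carrier
  B z L a b = sumTo L (λ k → (- z) ^ k * minor k (suc k) a b)

  boundary : Carrier → ℕ → Seq → Seq → Carrier
  boundary z L a b = (- z) ^ suc L * minor L (suc (suc L)) a b

  row : Carrier → ℕ → Seq
  row z n k = N n k z

  Λ : Carrier → ℕ → Seq → Carrier
  Λ z j a = (- 1#) ^ j * (a (double j) - (z + 1#) * a (suc (double j)) + z * a (suc (suc (double j))))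

  private
    -- Solver-level copies of sequences, T, T†, minor and Λ: solving an identity between them
    -- yields the corresponding identity between the operators above on the nose.
    seqₚ : ∀ {n} → List (Polynomial n) → ℕ → Polynomial n
    seqₚ []       _       = 0ₚ
    seqₚ (x ∷ _)  zero    = x
    seqₚ (_ ∷ xs) (suc k) = seqₚ xs k

    Tₚ : ∀ {n} → Polynomial n → (ℕ → Polynomial n) → ℕ → Polynomial n
    Tₚ z a zero    = (z :+ 1ₚ) :* a 0 :+ z :* a 1
    Tₚ z a (suc k) = a k :+ (z :+ 1ₚ) :* a (suc k) :+ z :* a (suc (suc k))

    T†ₚ : ∀ {n} → Polynomial n → (ℕ → Polynomial n) → ℕ → Polynomial n
    T†ₚ z a k = 2ₚ :* (z :+ 1ₚ) :* a k :- Tₚ z a k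

    minorₚ : ∀ {n} → ℕ → ℕ → (ℕ → Polynomial n) → (ℕ → Polynomial n) → Polynomial n
    minorₚ k l a b = a k :* b l :- a l :* b k

    Λₚ : ∀ {n} → Polynomial n → Polynomial n → (ℕ → Polynomial n) → ℕ → Polynomial n
    Λₚ s z a k = s :* (a k :- (z :+ 1ₚ) :* a (suc k) :+ z :* a (suc (suc k)))

  T-cong : ∀ z {a b} → a ≋ b → T z a ≋ T z b
  T-cong z a≋b zero    = +-cong (*-congˡ (a≋b 0)) (*-congˡ (a≋b 1))
  T-cong z a≋b (suc k) = +-cong (+-cong (a≋b k) (*-congˡ (a≋b (suc k)))) (*-congˡ (a≋b (suc (suc k))))

  T†-cong : ∀ z {a b} → a ≋ b → T† z a ≋ T† z b
  T†-cong z a≋b k = +-cong (*-congˡ (a≋b k)) (-‿cong (T-cong z a≋b k))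

  T-linear : ∀ z x a b → T z (λ k → x * a k - b k) ≋ (λ k → x * T z a k - T z b k)
  T-linear z x a b zero = solve 6 (λ z x a₀ a₁ b₀ b₁ →
    let A = seqₚ (a₀ ∷ a₁ ∷ []) ; B = seqₚ (b₀ ∷ b₁ ∷ []) in
      Tₚ z (λ k → x :* A k :- B k) 0 := x :* Tₚ z A 0 :- Tₚ z B 0) refl z x (a 0) (a 1) (b 0) (b 1)
  T-linear z x a b (suc k) = solve 8 (λ z x a₀ a₁ a₂ b₀ b₁ b₂ →
    let A = seqₚ (a₀ ∷ a₁ ∷ a₂ ∷ []) ; B = seqₚ (b₀ ∷ b₁ ∷ b₂ ∷ []) in
      Tₚ z (λ k → x :* A k :- B k) 1 := x :* Tₚ z A 1 :- Tₚ z B 1) refl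
      z x (a k) (a (suc k)) (a (suc (suc k))) (b k) (b (suc k)) (b (suc (suc k)))

  T-T†-comm : ∀ z a → T z (T† z a) ≋ T† z (T z a)
  T-T†-comm z a = T-linear z (two * (z + 1#)) a (T z a)

  row-suc : ∀ z n → row z (suc n) ≋ T z (row z n)
  row-suc z n zero    = refl
  row-suc z n (suc k) = refl

  row-vanishes : ∀ z {n k} → n < k → row z n k ≈ 0#
  row-vanishes z {zero}  {suc k} _         = refl
  row-vanishes z {suc n} {suc k} (s≤s n<k) = trans
    (+-cong (+-cong (row-vanishes z n<k) (*-congˡ (row-vanishes z (ℕₚ.m<n⇒m<1+n n<k))))
            (*-congˡ (row-vanishes z (ℕₚ.m<n⇒m<1+n (ℕₚ.m<n⇒m<1+n n<k)))))
    (solve 1 (λ z → 0ₚ :+ (z :+ 1ₚ) :* 0ₚ :+ z :* 0ₚ := 0ₚ) refl z)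

  minor-vanishesˡ : ∀ w k l a b → a k ≈ 0# → a l ≈ 0# → w * minor k l a b ≈ 0#
  minor-vanishesˡ w k l a b aₖ≈0 aₗ≈0 = trans (*-congˡ (+-cong (*-congʳ aₖ≈0) (-‿cong (*-congʳ aₗ≈0))))
    (solve 3 (λ w x y → w :* (0ₚ :* x :- 0ₚ :* y) := 0ₚ) refl w (b l) (b k))

  minor-vanishesʳ : ∀ w k l a b → b k ≈ 0# → b l ≈ 0# → w * minor k l a b ≈ 0#
  minor-vanishesʳ w k l a b bₖ≈0 bₗ≈0 = trans (*-congˡ (+-cong (*-congˡ bₗ≈0) (-‿cong (*-congˡ bₖ≈0))))
    (solve 3 (λ w x y → w :* (x :* 0ₚ :- y :* 0ₚ) := 0ₚ) refl w (a k) (a l))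

  B-cong : ∀ z L {a a′ b b′} → a ≋ a′ → b ≋ b′ → B z L a b ≈ B z L a′ b′
  B-cong z L a≋a′ b≋b′ = sumTo-cong L (λ k →
    *-congˡ (+-cong (*-cong (a≋a′ k) (b≋b′ (suc k))) (-‿cong (*-cong (a≋a′ (suc k)) (b≋b′ k)))))

  B-self : ∀ z L a → B z L a a ≈ 0#
  B-self z L a = sumTo-zero L (λ k → solve 3 (λ w x y → w :* (x :* y :- y :* x) := 0ₚ) refl _ (a k) (a (suc k)))

  B-extendˡ : ∀ z L a b → a (suc L) ≈ 0# → a (suc (suc L)) ≈ 0# → B z (suc L) a b ≈ B z L a b
  B-extendˡ z L a b a₁≈0 a₂≈0 = sumTo-extend L _ (minor-vanishesˡ _ (suc L) (suc (suc L)) a b a₁≈0 a₂≈0)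

  B-linearˡ : ∀ z L x a a′ b → B z L (λ k → x * a k - a′ k) b ≈ x * B z L a b - B z L a′ b
  B-linearˡ z L x a a′ b = trans
    (sumTo-cong L (λ k → solve 8 (λ w x a₀ a₁ a′₀ a′₁ b₀ b₁ →
        w :* ((x :* a₀ :- a′₀) :* b₁ :- (x :* a₁ :- a′₁) :* b₀)
          := x :* (w :* (a₀ :* b₁ :- a₁ :* b₀)) :- w :* (a′₀ :* b₁ :- a′₁ :* b₀)) refl
        ((- z) ^ k) x (a k) (a (suc k)) (a′ k) (a′ (suc k)) (b k) (b (suc k))))
    (sumTo-linear L x _ _)

  -- Summation by parts: the contributions of the off-diagonal entries of T cancel in pairs,
  -- except for the pair straddling the end of the range.
  B-T-telescope : ∀ z L a b →
    B z L a (T z b) + B z L (T z a) b ≈ two * (z + 1#) * B z L a b - boundary z L a b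
  B-T-telescope z zero a b = solve 7 (λ z a₀ a₁ a₂ b₀ b₁ b₂ →
    let A = seqₚ (a₀ ∷ a₁ ∷ a₂ ∷ []) ; B = seqₚ (b₀ ∷ b₁ ∷ b₂ ∷ []) in
    1ₚ :* minorₚ 0 1 A (Tₚ z B) :+ 1ₚ :* minorₚ 0 1 (Tₚ z A) B
      := 2ₚ :* (z :+ 1ₚ) :* (1ₚ :* minorₚ 0 1 A B) :- (:- z :* 1ₚ) :* minorₚ 0 2 A B) refl
    z (a 0) (a 1) (a 2) (b 0) (b 1) (b 2)
  B-T-telescope z (suc L) a b = begin
    (B z L a (T z b) + p) + (B z L (T z a) b + q)
      ≈⟨ solve 4 (λ x y p q → (x :+ p) :+ (y :+ q) := (x :+ y) :+ (p :+ q)) refl _ _ p q ⟩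
    (B z L a (T z b) + B z L (T z a) b) + (p + q)
      ≈⟨ +-cong (B-T-telescope z L a b) step ⟩
    (κ * B z L a b - boundary z L a b) + (κ * r + boundary z L a b - boundary z (suc L) a b)
      ≈⟨ solve 5 (λ κ x r y y′ → (κ :* x :- y) :+ (κ :* r :+ y :- y′) := κ :* (x :+ r) :- y′)
           refl κ _ r _ _ ⟩
    κ * (B z L a b + r) - boundary z (suc L) a b ∎
    where
    κ = two * (z + 1#)
    p = (- z) ^ suc L * minor (suc L) (suc (suc L)) a (T z b)
    q = (- z) ^ suc L * minor (suc L) (suc (suc L)) (T z a) b
    r = (- z) ^ suc L * minor (suc L) (suc (suc L)) a b
    step : p + q ≈ κ * r + boundary z L a b - boundary z (suc L) a b
    step = solve 10 (λ z w a₀ a₁ a₂ a₃ b₀ b₁ b₂ b₃ →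
      let A = seqₚ (a₀ ∷ a₁ ∷ a₂ ∷ a₃ ∷ []) ; B = seqₚ (b₀ ∷ b₁ ∷ b₂ ∷ b₃ ∷ []) in
      w :* minorₚ 1 2 A (Tₚ z B) :+ w :* minorₚ 1 2 (Tₚ z A) B
        := 2ₚ :* (z :+ 1ₚ) :* (w :* minorₚ 1 2 A B) :+ w :* minorₚ 0 2 A B :- (:- z :* w) :* minorₚ 1 3 A B) refl
      z ((- z) ^ suc L) (a L) (a (suc L)) (a (suc (suc L))) (a (suc (suc (suc L))))
      (b L) (b (suc L)) (b (suc (suc L))) (b (suc (suc (suc L))))

  B-adjoint : ∀ z L a b → boundary z L a b ≈ 0# → B z L a (T z b) ≈ B z L (T† z a) b
  B-adjoint z L a b boundary≈0 = begin
    B z L a (T z b)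
      ≈⟨ solve 2 (λ x y → x := (x :+ y) :- y) refl _ _ ⟩
    (B z L a (T z b) + B z L (T z a) b) - B z L (T z a) b
      ≈⟨ +-congʳ (B-T-telescope z L a b) ⟩
    (κ * B z L a b - boundary z L a b) - B z L (T z a) b
      ≈⟨ +-congʳ (+-congˡ (-‿cong boundary≈0)) ⟩
    (κ * B z L a b - 0#) - B z L (T z a) b
      ≈⟨ solve 2 (λ x y → (x :- 0ₚ) :- y := x :- y) refl _ _ ⟩
    κ * B z L a b - B z L (T z a) b
      ≈⟨ B-linearˡ z L κ a (T z a) b ⟨
    B z L (T† z a) b ∎
    where κ = two * (z + 1#)

  B-row₀ : ∀ z L a → B z L a (row z 0) ≈ - a 1
  B-row₀ z zero    a = solve 2 (λ a₀ a₁ → 1ₚ :* (a₀ :* 0ₚ :- a₁ :* 1ₚ) := :- a₁) refl (a 0) (a 1)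
  B-row₀ z (suc L) a =
    trans (sumTo-extend L _ (minor-vanishesʳ _ (suc L) (suc (suc L)) a (row z 0) refl refl)) (B-row₀ z L a)

  Λ-intertwines : ∀ z a → (λ j → Λ z j (T† z (T z a))) ≋ T (z * z) (λ j → Λ z j a)
  Λ-intertwines z a zero = solve 6 (λ z a₀ a₁ a₂ a₃ a₄ →
    let A = seqₚ (a₀ ∷ a₁ ∷ a₂ ∷ a₃ ∷ a₄ ∷ []) in
    Λₚ 1ₚ z (T†ₚ z (Tₚ z A)) 0
      := (z :* z :+ 1ₚ) :* Λₚ 1ₚ z A 0 :+ z :* z :* Λₚ (:- 1ₚ :* 1ₚ) z A 2) refl
    z (a 0) (a 1) (a 2) (a 3) (a 4)
  Λ-intertwines z a (suc j) = solve 9 (λ s z a₀ a₁ a₂ a₃ a₄ a₅ a₆ →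
    let A = seqₚ (a₀ ∷ a₁ ∷ a₂ ∷ a₃ ∷ a₄ ∷ a₅ ∷ a₆ ∷ []) in
    Λₚ (:- 1ₚ :* s) z (T†ₚ z (Tₚ z A)) 2
      := Λₚ s z A 0 :+ (z :* z :+ 1ₚ) :* Λₚ (:- 1ₚ :* s) z A 2
           :+ z :* z :* Λₚ (:- 1ₚ :* (:- 1ₚ :* s)) z A 4) refl
    ((- 1#) ^ j) z (a i) (a (1 ℕ.+ i)) (a (2 ℕ.+ i)) (a (3 ℕ.+ i)) (a (4 ℕ.+ i)) (a (5 ℕ.+ i)) (a (6 ℕ.+ i))
    where i = double j

  -T†≈Λ₀ : ∀ z a → - T† z a 1 ≈ Λ z 0 a
  -T†≈Λ₀ z a = solve 4 (λ z a₀ a₁ a₂ → let A = seqₚ (a₀ ∷ a₁ ∷ a₂ ∷ []) in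
    :- T†ₚ z A 1 := Λₚ 1ₚ z A 0) refl z (a 0) (a 1) (a 2)

  module _ (z : Carrier) where

    F-recurrence : ∀ m n → F (suc m) n z ≈ two * (z + 1#) * F m n z - F m (suc n) z
    F-recurrence m n = begin
      B z n (row z n) (row z (suc m))
        ≈⟨ B-cong z n (λ _ → refl) (row-suc z m) ⟩
      B z n (row z n) (T z (row z m))
        ≈⟨ B-extendˡ z n (row z n) _ (row-vanishes z (ℕₚ.n<1+n n)) (row-vanishes z n<2+n) ⟨
      B z (suc n) (row z n) (T z (row z m))
        ≈⟨ B-adjoint z (suc n) (row z n) (row z m) (minor-vanishesˡ _ (suc n) (suc (suc (suc n))) (row z n) (row z m)
             (row-vanishes z (ℕₚ.n<1+n n)) (row-vanishes z (ℕₚ.m<n⇒m<1+n n<2+n))) ⟩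
      B z (suc n) (T† z (row z n)) (row z m)
        ≈⟨ B-linearˡ z (suc n) (two * (z + 1#)) (row z n) (T z (row z n)) (row z m) ⟩
      two * (z + 1#) * B z (suc n) (row z n) (row z m) - B z (suc n) (T z (row z n)) (row z m)
        ≈⟨ +-cong (*-congˡ (B-extendˡ z n (row z n) (row z m) (row-vanishes z (ℕₚ.n<1+n n)) (row-vanishes z n<2+n)))
                  (-‿cong (B-cong z (suc n) (λ k → sym (row-suc z n k)) (λ _ → refl))) ⟩
      two * (z + 1#) * B z n (row z n) (row z m) - B z (suc n) (row z (suc n)) (row z m) ∎
      where n<2+n = ℕₚ.m<n⇒m<1+n (ℕₚ.n<1+n n)

    F-diagonal : ∀ n → F n n z ≈ 0#
    F-diagonal n = B-self z n (row z n)

    B-row : ∀ {r L} → r ≤ L → ∀ a → B z L a (row z r) ≈ B z L (iterate (T† z) r a) (row z 0)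
    B-row {zero}      _   a = refl
    B-row {suc r} {L} r<L a = begin
      B z L a (row z (suc r))
        ≈⟨ B-cong z L (λ _ → refl) (row-suc z r) ⟩
      B z L a (T z (row z r))
        ≈⟨ B-adjoint z L a (row z r) (minor-vanishesʳ _ L (suc (suc L)) a (row z r)
             (row-vanishes z r<L) (row-vanishes z (ℕₚ.m<n⇒m<1+n (ℕₚ.m<n⇒m<1+n r<L)))) ⟩
      B z L (T† z a) (row z r)
        ≈⟨ B-row (ℕₚ.<⇒≤ r<L) (T† z a) ⟩
      B z L (iterate (T† z) r (T† z a)) (row z 0)
        ≈⟨ B-cong z L (iterate-comm (T†-cong z) (T† z) (λ _ _ → refl) r a) (λ _ → refl) ⟩
      B z L (iterate (T† z) (suc r) a) (row z 0) ∎

    T†-power-row : ∀ n → iterate (T† z) n (row z n) ≋ iterate (T† z ∘ T z) n (row z 0)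
    T†-power-row zero    k = refl
    T†-power-row (suc n) = T†-cong z (λ k → begin
      iterate (T† z) n (row z (suc n)) k
        ≈⟨ iterate-cong (T†-cong z) n (row-suc z n) k ⟩
      iterate (T† z) n (T z (row z n)) k
        ≈⟨ iterate-comm (T†-cong z) (T z) (λ a j → sym (T-T†-comm z a j)) n (row z n) k ⟩
      T z (iterate (T† z) n (row z n)) k
        ≈⟨ T-cong z (T†-power-row n) k ⟩
      T z (iterate (T† z ∘ T z) n (row z 0)) k ∎)

    Λ-iterate : ∀ n j → Λ z j (iterate (T† z ∘ T z) n (row z 0)) ≈ N n j (z * z)
    Λ-iterate zero zero    = solve 1 (λ z → 1ₚ :* (1ₚ :- (z :+ 1ₚ) :* 0ₚ :+ z :* 0ₚ) := 1ₚ) refl z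
    Λ-iterate zero (suc j) = solve 2 (λ s z → s :* (0ₚ :- (z :+ 1ₚ) :* 0ₚ :+ z :* 0ₚ) := 0ₚ) refl _ z
    Λ-iterate (suc n) j = begin
      Λ z j (T† z (T z (iterate (T† z ∘ T z) n (row z 0))))
        ≈⟨ Λ-intertwines z _ j ⟩
      T (z * z) (λ i → Λ z i (iterate (T† z ∘ T z) n (row z 0))) j
        ≈⟨ T-cong (z * z) (Λ-iterate n) j ⟩
      T (z * z) (row (z * z) n) j
        ≈⟨ row-suc (z * z) n j ⟨
      N (suc n) j (z * z) ∎

    F-subdiagonal : ∀ n → F (suc n) n z ≈ Nar n (z * z)
    F-subdiagonal n = begin
      B z n (row z n) (row z (suc n))
        ≈⟨ B-extendˡ z n (row z n) (row z (suc n)) (row-vanishes z (ℕₚ.n<1+n n))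
             (row-vanishes z (ℕₚ.m<n⇒m<1+n (ℕₚ.n<1+n n))) ⟨
      B z (suc n) (row z n) (row z (suc n))
        ≈⟨ B-row {suc n} ℕₚ.≤-refl (row z n) ⟩
      B z (suc n) (iterate (T† z) (suc n) (row z n)) (row z 0)
        ≈⟨ B-row₀ z (suc n) (iterate (T† z) (suc n) (row z n)) ⟩
      - T† z (iterate (T† z) n (row z n)) 1
        ≈⟨ -‿cong (T†-cong z (T†-power-row n) 1) ⟩
      - T† z (iterate (T† z ∘ T z) n (row z 0)) 1
        ≈⟨ -T†≈Λ₀ z (iterate (T† z ∘ T z) n (row z 0)) ⟩
      Λ z 0 (iterate (T† z ∘ T z) n (row z 0))
        ≈⟨ Λ-iterate n 0 ⟩
      Nar n (z * z) ∎

    F-chebyshev : ∀ d n → F (suc (d ℕ.+ n)) n z ≈ chebyshev (two * (z + 1#)) (λ j → Nar (n ℕ.+ j) (z * z)) d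
    F-chebyshev = chebyshev-unique (two * (z + 1#)) (λ n → Nar n (z * z)) (λ d n → F (suc (d ℕ.+ n)) n z)
      F-subdiagonal F₁ Fₛ
      where
      F₁ : ∀ n → F (suc (suc n)) n z ≈ two * (z + 1#) * Nar n (z * z)
      F₁ n = begin
        F (suc (suc n)) n z
          ≈⟨ F-recurrence (suc n) n ⟩
        two * (z + 1#) * F (suc n) n z - F (suc n) (suc n) z
          ≈⟨ +-cong (*-congˡ (F-subdiagonal n)) (-‿cong (F-diagonal (suc n))) ⟩
        two * (z + 1#) * Nar n (z * z) - 0#
          ≈⟨ solve 1 (λ x → x :- 0ₚ := x) refl _ ⟩
        two * (z + 1#) * Nar n (z * z) ∎
      Fₛ : ∀ d n → F (suc (suc (suc (d ℕ.+ n)))) n z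
                   ≈ two * (z + 1#) * F (suc (suc (d ℕ.+ n))) n z - F (suc (d ℕ.+ suc n)) (suc n) z
      Fₛ d n = trans (F-recurrence (suc (suc (d ℕ.+ n))) n)
        (+-congˡ (-‿cong (reflexive (≡.cong (λ m → F (suc m) (suc n) z) (≡.sym (ℕₚ.+-suc d n))))))

    F-closedForm : ∀ m n → n < m → F m n z ≈ closedForm m n z
    F-closedForm m n n<m = begin
      F m n z
        ≡⟨ ≡.cong (λ m → F m n z) (≡.sym (suc[m∸n∸1+n]≡m n<m)) ⟩
      F (suc (m ∸ n ∸ 1 ℕ.+ n)) n z
        ≈⟨ F-chebyshev (m ∸ n ∸ 1) n ⟩
      chebyshev (two * (z + 1#)) (λ j → Nar (n ℕ.+ j) (z * z)) (m ∸ n ∸ 1)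
        ≈⟨ chebyshev-truncate (two * (z + 1#)) (λ j → Nar (n ℕ.+ j) (z * z)) (m ∸ n ∸ 1) ⟩
      closedForm m n z ∎

theorem3p5 : {c ℓ : Level} (R : CommutativeRing c ℓ) → let open Narayana R in
    (∀ (z : Carrier) (m n : ℕ) → F (suc m) n z ≈ two * (z + 1#) * F m n z - F m (suc n) z)
    ∧ (∀ (z : Carrier) (n : ℕ) → F n n z ≈ 0#)
    ∧ (∀ (z : Carrier) (n : ℕ) → F (suc n) n z ≈ Nar n (z * z))
    ∧ (∀ (z : Carrier) (m n : ℕ) → n < m → F m n z ≈ closedForm m n z)
theorem3p5 R = F-recurrence , F-diagonal , F-subdiagonal , F-closedForm
  where open NarayanaDeterminants R
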